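{- Let $(G,k)$ be an instance of CTVD and let $S$ be a (clique, tree)-deletion set of $G$ with $|S| \le 4k$. Let $V_1$ be the union of the vertex sets of the connected components of $G-S$ that are cliques with at least $3$ vertices, and $V_2 = V(G) \setminus (S \cup V_1)$. Let $v \in S$ and suppose that $G[V_2 \cup \{v\}]$ contains a $v$-flower of order $3k+2$. Then $(G,k)$ is a yes-instance if and only if $(G - v, k-1)$ is a yes-instance.
   Context: CTVD: given a multigraph $G$ (loops and parallel edges allowed) and an integer $k$, decide whether there is $S\subseteq V(G)$ with $|S|\le k$ such that $G-S$ is simple and every connected component of $G-S$ is a clique or a tree; instances with negative parameter are no-instances. A (clique, tree)-deletion set of $G$ is any $X \subseteq V(G)$ such that $G - X$ is simple and each of its connected components is a clique or a tree. For a vertex $v$ of a graph, a $v$-flower of order $\ell$ is a family of $\ell$ cycles all containing $v$ such that any two of them share no vertex other than $v$. -}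

module Defs where

open import Data.Nat as ℕ using (ℕ; zero; suc; _≤_)
open import Data.Integer as ℤ using (ℤ; +_)
open import Data.Fin using (Fin)
open import Data.Fin.Subset using (Subset; _∈_; _∉_; ∣_∣)
open import Data.List using (List; []; _∷_; length; filter; allFin)
open import Data.List.Relation.Unary.All using (All)
open import Data.List.Relation.Unary.Unique.Propositional using (Unique)
import Data.List.Membership.Propositional as LM
open import Data.Product using (Σ; ∃; _×_; _,_)
open import Data.Sum using (_⊎_)
open import Data.Unit using (⊤)
open import Data.Empty using (⊥)
open import Relation.Nullary using (¬_)
open import Relation.Binary.PropositionalEquality using (_≡_; _≢_)
open import Relation.Binary.Construct.Closure.ReflexiveTransitive using (Star)

-- The vertex set is a predicate V on Fin n;
-- mult u w is the number of edges between u and w (mult u u = number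
-- of loops at u).  Only edges between vertices of V are relevant.

record Graph : Set₁ where
  field
    n    : ℕ
    V    : Fin n → Set
    mult : Fin n → Fin n → ℕ
    sym  : ∀ u w → mult u w ≡ mult w u
open Graph public

_-ᵥ_ : (G : Graph) → Fin (n G) → Graph
G -ᵥ v = record { n = n G ; V = λ x → V G x × x ≢ v ; mult = mult G ; sym = sym G }

module _ (G : Graph) where
  private
    N = n G
    m = mult G

  VSet : Set₁
  VSet = Fin N → Set

  Adj : VSet → Fin N → Fin N → Set
  Adj W u w = W u × W w × u ≢ w × 1 ≤ m u w

  Conn : VSet → Fin N → Fin N → Set
  Conn W u w = W u × Star (Adj W) u w

  Simple : VSet → Set
  Simple W = (∀ u → W u → m u u ≡ 0) × (∀ u w → W u → W w → m u w ≤ 1)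

  -- cycles of the multigraph G[W], given by their (distinct) vertices in
  -- cyclic order: a loop (length 1), a pair of parallel edges (length 2),
  -- or an ordinary cycle of length ≥ 3
  CloseFrom : Fin N → Fin N → List (Fin N) → Set
  CloseFrom s x []      = 1 ≤ m x s
  CloseFrom s x (y ∷ r) = 1 ≤ m x y × CloseFrom s y r

  CycleEdges : List (Fin N) → Set
  CycleEdges []                = ⊥
  CycleEdges (x ∷ [])          = 1 ≤ m x x
  CycleEdges (x ∷ y ∷ [])      = 2 ≤ m x y
  CycleEdges (x ∷ y ∷ z ∷ r)   = CloseFrom x x (y ∷ z ∷ r)

  record Cycle (W : VSet) : Set where
    field
      verts    : List (Fin N)
      distinct : Unique verts
      inside   : All W verts
      edges    : CycleEdges verts
  open Cycle public

  CompClique : VSet → Fin N → Set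
  CompClique W u = ∀ a b → Conn W u a → Conn W u b → a ≢ b → 1 ≤ m a b

  CompTree : VSet → Fin N → Set
  CompTree W u = ¬ Cycle (Conn W u)

  Minus : Subset N → VSet
  Minus X x = V G x × x ∉ X

  CTDelSet : Subset N → Set
  CTDelSet X = (∀ x → x ∈ X → V G x)
             × Simple (Minus X)
             × (∀ u → Minus X u → CompClique (Minus X) u ⊎ CompTree (Minus X) u)

  -- yes-instance of CTVD (automatically false for negative k)
  YesCTVD : ℤ → Set
  YesCTVD k = Σ (Subset N) λ X → (+ ∣ X ∣) ℤ.≤ k × CTDelSet X

  InV1 : Subset N → Fin N → Set
  InV1 S u = Minus S u × CompClique (Minus S) u
           × Σ (Fin N) λ a → Σ (Fin N) λ b → Σ (Fin N) λ c →
               Conn (Minus S) u a × Conn (Minus S) u b × Conn (Minus S) u c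
               × a ≢ b × a ≢ c × b ≢ c

  InV2 : Subset N → Fin N → Set
  InV2 S x = V G x × x ∉ S × ¬ InV1 S x

  -- v-flower of order ℓ in G[W]: ℓ cycles through v, pairwise sharing only
  -- v; distinct loops at v are distinct cycles, so the number of
  -- length-1 cycles (necessarily loops at v) is at most mult v v.
  record Flower (W : VSet) (v : Fin N) (ℓ : ℕ) : Set where
    field
      cyc      : Fin ℓ → Cycle W
      throughV : ∀ i → v LM.∈ verts (cyc i)
      disjoint : ∀ i j → i ≢ j → ∀ x → x LM.∈ verts (cyc i) → x LM.∈ verts (cyc j) → x ≡ v
      loops    : length (filter (λ i → length (verts (cyc i)) ℕ.≟ 1) (allFin ℓ)) ≤ m v v

-- If a solution X of size at most k avoided v, it could meet at most ∣ X ∣ ≤ k of the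
-- 3k + 2 petals, since distinct petals share only v; so two petals would survive in G - X.
-- A surviving petal is a cycle through v in a simple graph, so the component of v in G - X
-- is a clique and contains two vertices of one petal besides v and one of the other. These
-- three vertices lie in V₂ and form a triangle, which is impossible: in G - S their component
-- would be either a tree or a clique on at least three vertices, i.e. part of V₁. Hence every
-- small solution contains v, and X ↦ X - v matches solutions of (G, k) with those of (G - v, k - 1).

module Submission where

open import Defs
open import Data.Nat using (ℕ)
open import Data.Integer using (ℤ; +_; _+_; _-_; _*_; _≤_)
open import Data.Fin using (Fin)
open import Data.Fin.Subset using (Subset; _∈_; ∣_∣)
open import Data.Sum using (_⊎_)
open import Relation.Binary.PropositionalEquality using (_≡_)
open import Function.Bundles using (_⇔_; mk⇔; Equivalence)

open import Data.Bool using (true; false)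
open import Data.Nat as ℕ using (z≤n; s≤s)
import Data.Nat.Properties as ℕ
open import Data.Integer as ℤ using (+≤+; +<+; _<_)
import Data.Integer.Properties as ℤ
open import Data.Fin.Properties using (_≟_)
open import Data.Fin.Subset using (_∉_; ⁅_⁆; _∪_; _─_)
import Data.Fin.Subset as Subset
import Data.Fin.Subset.Properties as Subset
open import Data.Vec using ([]; _∷_; here; there)
open import Data.List using (List; []; _∷_; length; filter)
open import Data.List.Properties using (length-tabulate)
open import Data.List.Relation.Unary.All as All using (All; []; _∷_)
open import Data.List.Relation.Unary.All.Properties using (all-filter)
open import Data.List.Relation.Unary.AllPairs using ([]; _∷_)
open import Data.List.Relation.Unary.Any using (here; there; any?)
open import Data.List.Relation.Unary.Unique.Propositional using (Unique)
import Data.List.Relation.Unary.Unique.Propositional.Properties as Unique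
open import Data.List.Membership.Propositional as List using (find; lose)
open import Data.Product using (∃; ∃₂; _×_; _,_; proj₁; map₂)
open import Data.Sum as Sum using (inj₁; inj₂; [_,_])
open import Data.Empty using (⊥; ⊥-elim)
open import Function using (id; _∘_)
open import Relation.Nullary using (¬_; yes; no; does)
open import Relation.Nullary.Decidable using (map′)
open import Relation.Unary using (Pred; Decidable; _⊆_)
open import Relation.Unary.Properties using (∁?)
open import Relation.Binary.Definitions using (DecidableEquality)
open import Relation.Binary.PropositionalEquality using (refl; trans; cong; subst; _≢_; module ≡-Reasoning)
  renaming (sym to ≡-sym)
open import Relation.Binary.Construct.Closure.ReflexiveTransitive as Star using (Star; ε; _◅_; _◅◅_)

length-filter+length-filter-∁ : ∀ {p} {A : Set} {P : Pred A p} (P? : Decidable P) (xs : List A) →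
  length (filter P? xs) ℕ.+ length (filter (∁? P?) xs) ≡ length xs
length-filter+length-filter-∁ P? [] = refl
length-filter+length-filter-∁ P? (x ∷ xs) with does (P? x)
... | true  = cong ℕ.suc (length-filter+length-filter-∁ P? xs)
... | false = trans (ℕ.+-suc _ _) (cong ℕ.suc (length-filter+length-filter-∁ P? xs))

two-of-unique : ∀ {q} {A : Set} {Q : Pred A q} {xs : List A} → Unique xs → All Q xs → 2 ℕ.≤ length xs →
                ∃₂ λ x y → x ≢ y × Q x × Q y
two-of-unique ((x≢y ∷ _) ∷ _) (qx ∷ qy ∷ _) (s≤s (s≤s z≤n)) = _ , _ , x≢y , qx , qy

two-besides : ∀ {A : Set} → DecidableEquality A → ∀ (v : A) {xs : List A} → Unique xs → 3 ℕ.≤ length xs →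
              ∃₂ λ a b → a ≢ b × a ≢ v × b ≢ v × a List.∈ xs × b List.∈ xs
two-besides _≟_ v {x ∷ y ∷ z ∷ _} ((x≢y ∷ x≢z ∷ _) ∷ (y≢z ∷ _) ∷ _) (s≤s (s≤s (s≤s _))) with x ≟ v | y ≟ v
... | yes refl | _        = y , z , y≢z , x≢y ∘ ≡-sym , x≢z ∘ ≡-sym , there (here refl) , there (there (here refl))
... | no x≢v   | yes refl = x , z , x≢z , x≢v , y≢z ∘ ≡-sym , here refl , there (there (here refl))
... | no x≢v   | no y≢v   = x , y , x≢y , x≢v , y≢v , here refl , there (here refl)

∣p∪q∣≤∣p∣+∣q∣ : ∀ {N} (p q : Subset N) → ∣ p ∪ q ∣ ℕ.≤ ∣ p ∣ ℕ.+ ∣ q ∣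
∣p∪q∣≤∣p∣+∣q∣ []                   []                   = z≤n
∣p∪q∣≤∣p∣+∣q∣ (Subset.inside  ∷ p) (t              ∷ q) =
  s≤s (ℕ.≤-trans (∣p∪q∣≤∣p∣+∣q∣ p q) (ℕ.+-monoʳ-≤ ∣ p ∣ (Subset.∣p∣≤∣x∷p∣ t q)))
∣p∪q∣≤∣p∣+∣q∣ (Subset.outside ∷ p) (Subset.inside  ∷ q) =
  ℕ.≤-trans (s≤s (∣p∪q∣≤∣p∣+∣q∣ p q)) (ℕ.≤-reflexive (≡-sym (ℕ.+-suc ∣ p ∣ ∣ q ∣)))
∣p∪q∣≤∣p∣+∣q∣ (Subset.outside ∷ p) (Subset.outside ∷ q) = ∣p∪q∣≤∣p∣+∣q∣ p q

x∈p─q⇒x∉q : ∀ {N} (p q : Subset N) {x : Fin N} → x ∈ p ─ q → x ∉ q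
x∈p─q⇒x∉q (_ ∷ p) (_              ∷ q) {Fin.suc x} (there x∈p─q) (there x∈q) = x∈p─q⇒x∉q p q x∈p─q x∈q
x∈p─q⇒x∉q (_ ∷ p) (Subset.outside ∷ q) {Fin.zero}  here ()
x∈p─q⇒x∉q (_ ∷ p) (Subset.inside  ∷ q) {Fin.zero}  ()

i<j⇒i≤j-1 : ∀ {i j : ℤ} → i < j → i ≤ j - + 1
i<j⇒i≤j-1 {j = j} i<j = subst (_ ≤_) (ℤ.+-comm ℤ.-1ℤ j) (ℤ.i<j⇒i≤pred[j] i<j)

i≤j-1⇒i<j : ∀ {i j : ℤ} → i ≤ j - + 1 → i < j
i≤j-1⇒i<j {j = j} i≤j-1 = ℤ.i≤pred[j]⇒i<j (subst (_ ≤_) (ℤ.+-comm j ℤ.-1ℤ) i≤j-1)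

m≤k∧ℓ≡3k+2⇒m+2≤ℓ : ∀ {m ℓ k} → + m ≤ k → + ℓ ≡ + 3 * k + + 2 → m ℕ.+ 2 ℕ.≤ ℓ
m≤k∧ℓ≡3k+2⇒m+2≤ℓ {m} {ℓ} {+ k} (+≤+ m≤k) ℓ≡3k+2 =
  subst (m ℕ.+ 2 ℕ.≤_) (≡-sym ℓ≡3k+2ᴺ) (ℕ.+-monoˡ-≤ 2 (ℕ.≤-trans m≤k (ℕ.m≤n*m k 3)))
  where
    ℓ≡3k+2ᴺ : ℓ ≡ 3 ℕ.* k ℕ.+ 2
    ℓ≡3k+2ᴺ = ℤ.+-injective (begin
      + ℓ                  ≡⟨ ℓ≡3k+2 ⟩
      + 3 * + k + + 2      ≡⟨ cong (_+ + 2) (ℤ.pos-* 3 k) ⟨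
      + (3 ℕ.* k) + + 2    ≡⟨ ℤ.pos-+ (3 ℕ.* k) 2 ⟨
      + (3 ℕ.* k ℕ.+ 2)    ∎)
      where open ≡-Reasoning

module _ {I : Set} {N : ℕ} (P : I → List (Fin N)) where

  Meets : Subset N → I → Set
  Meets X i = ∃ λ x → x ∈ X × x List.∈ P i

  meets? : ∀ X → Decidable (Meets X)
  meets? X i = map′ (λ m → let x , x∈Pi , x∈X = find m in x , x∈X , x∈Pi)
                    (λ (x , x∈X , x∈Pi) → lose x∈Pi x∈X)
                    (any? (Subset._∈? X) (P i))

  DisjointOn : Subset N → Set
  DisjointOn X = ∀ {i j} → i ≢ j → ∀ {x} → x ∈ X → x List.∈ P i → x List.∈ P j → ⊥

  length-meeting≤ : ∀ X → DisjointOn X → ∀ {is} → Unique is → All (Meets X) is → length is ℕ.≤ ∣ X ∣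
  length-meeting≤ X disj [] [] = z≤n
  length-meeting≤ X disj {i ∷ _} (i∉is ∷ unique) ((x , x∈X , x∈Pi) ∷ meets) =
    ℕ.≤-trans (s≤s (length-meeting≤ (X Subset.- x) disj-x unique (All.zipWith meets-x (i∉is , meets))))
              (Subset.x∈p⇒∣p-x∣<∣p∣ x∈X)
    where
      disj-x : DisjointOn (X Subset.- x)
      disj-x i≢j y∈X-x = disj i≢j (Subset.p─q⊆p X ⁅ x ⁆ y∈X-x)

      meets-x : ∀ {j} → i ≢ j × Meets X j → Meets (X Subset.- x) j
      meets-x (i≢j , y , y∈X , y∈Pj) =
        y , Subset.x∈p∧x≢y⇒x∈p-y y∈X (λ { refl → disj i≢j x∈X x∈Pi y∈Pj }) , y∈Pj

  two-avoiding : ∀ X → DisjointOn X → ∀ {is} → Unique is → ∣ X ∣ ℕ.+ 2 ℕ.≤ length is →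
                 ∃₂ λ i j → i ≢ j × ¬ Meets X i × ¬ Meets X j
  two-avoiding X disj {is} unique long =
    two-of-unique (Unique.filter⁺ (∁? (meets? X)) unique) (all-filter (∁? (meets? X)) is) two≤∣avoiding∣
    where
      meeting avoiding : List I
      meeting  = filter (meets? X) is
      avoiding = filter (∁? (meets? X)) is

      two≤∣avoiding∣ : 2 ℕ.≤ length avoiding
      two≤∣avoiding∣ = ℕ.+-cancelˡ-≤ ∣ X ∣ 2 _ (begin
        ∣ X ∣ ℕ.+ 2                          ≤⟨ long ⟩
        length is                            ≡⟨ length-filter+length-filter-∁ (meets? X) is ⟨
        length meeting ℕ.+ length avoiding   ≤⟨ ℕ.+-monoˡ-≤ _ ∣meeting∣≤∣X∣ ⟩
        ∣ X ∣ ℕ.+ length avoiding            ∎)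
        where
          open ℕ.≤-Reasoning
          ∣meeting∣≤∣X∣ : length meeting ℕ.≤ ∣ X ∣
          ∣meeting∣≤∣X∣ = length-meeting≤ X disj (Unique.filter⁺ (meets? X) unique) (all-filter (meets? X) is)

CTGraph : (G : Graph) → VSet G → Set
CTGraph G W = Simple G W × (∀ u → W u → CompClique G W u ⊎ CompTree G W u)

module _ (G : Graph) where

  module _ {W W' : VSet G} (W⊆W' : W ⊆ W') where

    Adj-mono : ∀ {u w} → Adj G W u w → Adj G W' u w
    Adj-mono (Wu , Ww , u≢w , edge) = W⊆W' Wu , W⊆W' Ww , u≢w , edge

    Conn-mono : ∀ {u w} → Conn G W u w → Conn G W' u w
    Conn-mono (Wu , path) = W⊆W' Wu , Star.map Adj-mono path

  cycle-within : ∀ {W W'} (C : Cycle G W) → All W' (verts C) → Cycle G W'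
  cycle-within C W'C = record { verts = verts C ; distinct = distinct C ; inside = W'C ; edges = edges C }

  CTGraph-⊆ : ∀ {W W'} → W' ⊆ W → CTGraph G W → CTGraph G W'
  CTGraph-⊆ W'⊆W ((loopless , ≤1) , components) =
    ((λ u → loopless u ∘ W'⊆W) , (λ u w W'u W'w → ≤1 u w (W'⊆W W'u) (W'⊆W W'w))) ,
    λ u W'u → Sum.map (λ clique a b ua ub → clique a b (Conn-mono W'⊆W ua) (Conn-mono W'⊆W ub))
                      (λ tree C → tree (cycle-within C (All.map (Conn-mono W'⊆W) (inside C))))
                      (components u (W'⊆W W'u))

  module _ (v : Fin (n G)) where

    closeFrom-─ᵥ : ∀ s x xs → CloseFrom G s x xs ⇔ CloseFrom (G -ᵥ v) s x xs
    closeFrom-─ᵥ s x []       = mk⇔ id id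
    closeFrom-─ᵥ s x (y ∷ ys) = mk⇔ (map₂ to) (map₂ from)
      where open Equivalence (closeFrom-─ᵥ s y ys)

    cycleEdges-─ᵥ : ∀ xs → CycleEdges G xs ⇔ CycleEdges (G -ᵥ v) xs
    cycleEdges-─ᵥ []              = mk⇔ id id
    cycleEdges-─ᵥ (x ∷ [])        = mk⇔ id id
    cycleEdges-─ᵥ (x ∷ y ∷ [])    = mk⇔ id id
    cycleEdges-─ᵥ (x ∷ y ∷ z ∷ r) = closeFrom-─ᵥ x x (y ∷ z ∷ r)

    cycle-─ᵥ : ∀ {W} → Cycle G W ⇔ Cycle (G -ᵥ v) W
    cycle-─ᵥ = mk⇔
      (λ C → record { verts = verts C ; distinct = distinct C ; inside = inside C
                    ; edges = Equivalence.to (cycleEdges-─ᵥ (verts C)) (edges C) })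
      (λ C → record { verts = verts C ; distinct = distinct C ; inside = inside C
                    ; edges = Equivalence.from (cycleEdges-─ᵥ (verts C)) (edges C) })

    CTGraph-─ᵥ : ∀ {W} → CTGraph G W ⇔ CTGraph (G -ᵥ v) W
    CTGraph-─ᵥ = mk⇔
      (map₂ λ components u Wu → Sum.map₂ (λ tree → tree ∘ Equivalence.from cycle-─ᵥ) (components u Wu))
      (map₂ λ components u Wu → Sum.map₂ (λ tree → tree ∘ Equivalence.to cycle-─ᵥ) (components u Wu))

    CTDelSet-─ᵥ : ∀ {X} → CTDelSet G X → v ∈ X → CTDelSet (G -ᵥ v) (X Subset.- v)
    CTDelSet-─ᵥ {X} (X⊆V , ct) v∈X =
      (λ x x∈X-v → X⊆V x (Subset.p─q⊆p X ⁅ v ⁆ x∈X-v) ,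
                   λ { refl → x∈p─q⇒x∉q X ⁅ v ⁆ x∈X-v (Subset.x∈⁅x⁆ v) }) ,
      Equivalence.to CTGraph-─ᵥ (CTGraph-⊆ shrink ct)
      where
        shrink : Minus (G -ᵥ v) (X Subset.- v) ⊆ Minus G X
        shrink ((Vx , x≢v) , x∉X-v) = Vx , λ x∈X → x∉X-v (Subset.x∈p∧x≢y⇒x∈p-y x∈X x≢v)

    CTDelSet-∪ᵥ : ∀ {Y} → V G v → CTDelSet (G -ᵥ v) Y → CTDelSet G (Y ∪ ⁅ v ⁆)
    CTDelSet-∪ᵥ {Y} Vv (Y⊆V , ct) =
      (λ x x∈Y∪v → [ proj₁ ∘ Y⊆V x , (λ x∈v → subst (V G) (≡-sym (Subset.x∈⁅y⁆⇒x≡y v x∈v)) Vv) ]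
                     (Subset.x∈p∪q⁻ Y ⁅ v ⁆ x∈Y∪v)) ,
      CTGraph-⊆ shrink (Equivalence.from CTGraph-─ᵥ ct)
      where
        shrink : Minus G (Y ∪ ⁅ v ⁆) ⊆ Minus (G -ᵥ v) Y
        shrink {x} (Vx , x∉Y∪v) =
          (Vx , λ { refl → x∉Y∪v (Subset.x∈p∪q⁺ (inj₂ (Subset.x∈⁅x⁆ x))) }) ,
          x∉Y∪v ∘ Subset.x∈p∪q⁺ ∘ inj₁

    YesCTVD-─ᵥ : ∀ {k} → V G v → (∀ X → CTDelSet G X → + ∣ X ∣ ≤ k → v ∈ X) →
                 YesCTVD G k ⇔ YesCTVD (G -ᵥ v) (k - + 1)
    YesCTVD-─ᵥ Vv forced = mk⇔
      (λ (X , ∣X∣≤k , ct) → let v∈X = forced X ct ∣X∣≤k in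
        X Subset.- v , i<j⇒i≤j-1 (ℤ.<-≤-trans (+<+ (Subset.x∈p⇒∣p-x∣<∣p∣ v∈X)) ∣X∣≤k) , CTDelSet-─ᵥ ct v∈X)
      (λ (Y , ∣Y∣≤k-1 , ct) →
        Y ∪ ⁅ v ⁆ , ℤ.≤-trans (+≤+ (∣Y∪v∣≤1+∣Y∣ Y)) (ℤ.i<j⇒suc[i]≤j (i≤j-1⇒i<j ∣Y∣≤k-1)) , CTDelSet-∪ᵥ Vv ct)
      where
        ∣Y∪v∣≤1+∣Y∣ : ∀ Y → ∣ Y ∪ ⁅ v ⁆ ∣ ℕ.≤ ℕ.suc ∣ Y ∣
        ∣Y∪v∣≤1+∣Y∣ Y = ℕ.≤-trans (∣p∪q∣≤∣p∣+∣q∣ Y ⁅ v ⁆)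
                            (ℕ.≤-reflexive (trans (cong (∣ Y ∣ ℕ.+_) (Subset.∣⁅x⁆∣≡1 v)) (ℕ.+-comm ∣ Y ∣ 1)))

  module _ {W : VSet G} where

    Adj-sym : ∀ {u w} → Adj G W u w → Adj G W w u
    Adj-sym {u} {w} (Wu , Ww , u≢w , edge) = Ww , Wu , u≢w ∘ ≡-sym , subst (1 ℕ.≤_) (sym G u w) edge

    cycleEdges⇒closeFrom : ∀ x r → CycleEdges G (x ∷ r) → CloseFrom G x x r
    cycleEdges⇒closeFrom x []          loop     = loop
    cycleEdges⇒closeFrom x (y ∷ [])    parallel =
      ℕ.≤-trans (s≤s z≤n) parallel , subst (1 ℕ.≤_) (sym G x y) (ℕ.≤-trans (s≤s z≤n) parallel)
    cycleEdges⇒closeFrom x (y ∷ z ∷ r) closed   = closed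

    reach-along : ∀ s x r → CloseFrom G s x r → All W (x ∷ r) → Unique (x ∷ r) →
                  All (Star (Adj G W) x) (x ∷ r)
    reach-along s x []       _           _             _                   = ε ∷ []
    reach-along s x (y ∷ r) (edge , path) (Wx ∷ Wyr@(Wy ∷ _)) ((x≢y ∷ _) ∷ unique) =
      ε ∷ All.map ((Wx , Wy , x≢y , edge) ◅_) (reach-along s y r path Wyr unique)

    cycle-connected : (C : Cycle G W) → ∀ {a b} → a List.∈ verts C → b List.∈ verts C → Conn G W a b
    cycle-connected C a∈C b∈C with verts C | distinct C | inside C | edges C
    ... | x ∷ r | unique | Wxr | closed =
      All.lookup Wxr a∈C ,
      Star.reverse Adj-sym (All.lookup from-x a∈C) ◅◅ All.lookup from-x b∈C
      where
        from-x : All (Star (Adj G W) x) (x ∷ r)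
        from-x = reach-along x x r (cycleEdges⇒closeFrom x r closed) Wxr unique

    simple-cycle-length : Simple G W → (C : Cycle G W) → 3 ℕ.≤ length (verts C)
    simple-cycle-length (loopless , ≤1) C with verts C | inside C | edges C
    ... | x ∷ []        | Wx ∷ []       | loop     = ⊥-elim (ℕ.1+n≰n (subst (1 ℕ.≤_) (loopless x Wx) loop))
    ... | x ∷ y ∷ []    | Wx ∷ Wy ∷ []  | parallel = ⊥-elim (ℕ.1+n≰n (ℕ.≤-trans parallel (≤1 x y Wx Wy)))
    ... | x ∷ y ∷ z ∷ r | _             | _        = s≤s (s≤s (s≤s z≤n))

    cycle⇒clique : CTGraph G W → (C : Cycle G W) → ∀ {v} → v List.∈ verts C → CompClique G W v
    cycle⇒clique (_ , components) C v∈C with components _ (All.lookup (inside C) v∈C)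
    ... | inj₁ clique = clique
    ... | inj₂ tree   = ⊥-elim (tree (cycle-within C (All.tabulate (cycle-connected C v∈C))))

  triangle : ∀ {W a b c} → W a → W b → W c → a ≢ b → a ≢ c → b ≢ c →
             1 ℕ.≤ mult G a b → 1 ℕ.≤ mult G a c → 1 ℕ.≤ mult G b c → Cycle G W
  triangle {a = a} {c = c} Wa Wb Wc a≢b a≢c b≢c ab ac bc = record
    { verts    = a ∷ _ ∷ c ∷ []
    ; distinct = (a≢b ∷ a≢c ∷ []) ∷ (b≢c ∷ []) ∷ [] ∷ []
    ; inside   = Wa ∷ Wb ∷ Wc ∷ []
    ; edges    = ab , bc , subst (1 ℕ.≤_) (sym G a c) ac
    }

  V2-triangle-free : ∀ {S} → CTDelSet G S → ∀ {a b c} → InV2 G S a → InV2 G S b → InV2 G S c →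
                     a ≢ b → a ≢ c → b ≢ c → 1 ℕ.≤ mult G a b → 1 ℕ.≤ mult G a c → 1 ℕ.≤ mult G b c → ⊥
  V2-triangle-free {S} (_ , _ , components) {a} {b} {c} (Va , a∉S , a∉V1) (Vb , b∉S , _) (Vc , c∉S , _)
                   a≢b a≢c b≢c ab ac bc =
    [ (λ clique → a∉V1 ((Va , a∉S) , clique , a , b , c ,
                        a~ (here refl) , a~ (there (here refl)) , a~ (there (there (here refl))) ,
                        a≢b , a≢c , b≢c))
    , (λ tree → tree (cycle-within abc (All.tabulate a~)))
    ] (components a (Va , a∉S))
    where
      abc : Cycle G (Minus G S)
      abc = triangle (Va , a∉S) (Vb , b∉S) (Vc , c∉S) a≢b a≢c b≢c ab ac bc
      a~ : ∀ {x} → x List.∈ verts abc → Conn G (Minus G S) a x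
      a~ = cycle-connected abc (here refl)

  module _ {S : Subset (n G)} (ctS : CTDelSet G S) {v : Fin (n G)} (v∈S : v ∈ S)
           {ℓ : ℕ} (F : Flower G (λ x → InV2 G S x ⊎ x ≡ v) v ℓ) where

    open Flower F

    petal : Fin ℓ → List (Fin (n G))
    petal i = verts (cyc i)

    petal-in-V2 : ∀ i {a} → a List.∈ petal i → a ≢ v → InV2 G S a
    petal-in-V2 i a∈i a≢v = [ id , ⊥-elim ∘ a≢v ] (All.lookup (inside (cyc i)) a∈i)

    avoiding-petal : ∀ {X} i → ¬ Meets petal X i → Cycle G (Minus G X)
    avoiding-petal {X} i i-avoids = cycle-within (cyc i)
      (All.zipWith in-G-X (inside (cyc i) , All.tabulate λ x∈i x∈X → i-avoids (_ , x∈X , x∈i)))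
      where
        in-G-X : ∀ {x} → (InV2 G S x ⊎ x ≡ v) × x ∉ X → Minus G X x
        in-G-X (inj₁ (Vx , _) , x∉X) = Vx , x∉X
        in-G-X (inj₂ refl     , x∉X) = proj₁ ctS v v∈S , x∉X

    avoiding-petal-vertices : ∀ {X} → CTDelSet G X → ∀ i → ¬ Meets petal X i →
      ∃₂ λ a b → a ≢ b × a ≢ v × b ≢ v × a List.∈ petal i × b List.∈ petal i
    avoiding-petal-vertices (_ , simple , _) i i-avoids =
      two-besides _≟_ v (distinct (cyc i)) (simple-cycle-length simple (avoiding-petal i i-avoids))

    two-avoiding-petals-impossible : ∀ {X} → CTDelSet G X → ∀ {i j} → i ≢ j →
                                     ¬ Meets petal X i → ¬ Meets petal X j → ⊥
    two-avoiding-petals-impossible {X} ctX@(_ , ctGX) {i} {j} i≢j i-avoids j-avoids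
      with avoiding-petal-vertices ctX i i-avoids | avoiding-petal-vertices ctX j j-avoids
    ... | a , b , a≢b , a≢v , b≢v , a∈i , b∈i | c , _ , _ , c≢v , _ , c∈j , _ =
      V2-triangle-free ctS (petal-in-V2 i a∈i a≢v) (petal-in-V2 i b∈i b≢v) (petal-in-V2 j c∈j c≢v)
        a≢b a≢c b≢c (clique a b (v~i a∈i) (v~i b∈i) a≢b) (clique a c (v~i a∈i) (v~j c∈j) a≢c)
        (clique b c (v~i b∈i) (v~j c∈j) b≢c)
      where
        clique : CompClique G (Minus G X) v
        clique = cycle⇒clique ctGX (avoiding-petal i i-avoids) (throughV i)

        v~i : ∀ {x} → x List.∈ petal i → Conn G (Minus G X) v x
        v~i = cycle-connected (avoiding-petal i i-avoids) (throughV i)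

        v~j : ∀ {x} → x List.∈ petal j → Conn G (Minus G X) v x
        v~j = cycle-connected (avoiding-petal j j-avoids) (throughV j)

        apart : ∀ {x} → x List.∈ petal i → x ≢ v → x ≢ c
        apart x∈i x≢v refl = x≢v (disjoint i j i≢j _ x∈i c∈j)

        a≢c : a ≢ c
        a≢c = apart a∈i a≢v

        b≢c : b ≢ c
        b≢c = apart b∈i b≢v

    petals-disjoint : ∀ {X} → v ∉ X → DisjointOn petal X
    petals-disjoint {X} v∉X i≢j x∈X x∈i x∈j = v∉X (subst (_∈ X) (disjoint _ _ i≢j _ x∈i x∈j) x∈X)

    centre∈small-deletion-set : ∀ {X} → CTDelSet G X → ∣ X ∣ ℕ.+ 2 ℕ.≤ ℓ → v ∈ X
    centre∈small-deletion-set {X} ctX small with v Subset.∈? X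
    ... | yes v∈X = v∈X
    ... | no  v∉X =
      let i , j , i≢j , i-avoids , j-avoids =
            two-avoiding petal X (petals-disjoint v∉X) (Unique.allFin⁺ ℓ)
                         (subst (_ ℕ.≤_) (≡-sym (length-tabulate id)) small)
      in ⊥-elim (two-avoiding-petals-impossible ctX i≢j i-avoids j-avoids)

lemma28 : (G : Graph) (k : ℤ) (S : Subset (n G)) → CTDelSet G S → + ∣ S ∣ ≤ + 4 * k →
          (v : Fin (n G)) → v ∈ S → (ℓ : ℕ) → + ℓ ≡ + 3 * k + + 2 →
          Flower G (λ x → InV2 G S x ⊎ x ≡ v) v ℓ →
          (YesCTVD G k ⇔ YesCTVD (G -ᵥ v) (k - + 1))
-- The bound on ∣ S ∣ only matters for the kernel size in the paper; the equivalence holds without it.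
lemma28 G k S ctS _ v v∈S ℓ ℓ≡3k+2 F =
  YesCTVD-─ᵥ G v (proj₁ ctS v v∈S) λ X ctX ∣X∣≤k →
    centre∈small-deletion-set G ctS v∈S F ctX (m≤k∧ℓ≡3k+2⇒m+2≤ℓ ∣X∣≤k ℓ≡3k+2)
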